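{- (Master Theorem.) Let $\varphi$ be an LTL formula in negation normal form and let $w$ be an infinite word over $2^{Ap}$. Then $w \models \varphi$ if and only if there exist sets $X \subseteq \mu(\varphi)$ and $Y \subseteq \nu(\varphi)$ satisfying all of the following: (1) there exists $i \geq 0$ such that $w_i \models \varphi_i[X]_\nu$, where $\varphi_i := \mathit{af}(\varphi, w_{0i})$; (2) for every $\psi \in X$: $w \models \mathbf{G}\mathbf{F}(\psi[Y]_\mu)$; (3) for every $\psi \in Y$: $w \models \mathbf{F}\mathbf{G}(\psi[X]_\nu)$.
   Context: LTL formulas in negation normal form over a finite set $Ap$ of atomic propositions are given by $\varphi ::= \mathbf{tt} \mid \mathbf{ff} \mid a \mid \neg a \mid \varphi\wedge\varphi \mid \varphi\vee\varphi \mid \mathbf{X}\varphi \mid \mathbf{F}\varphi \mid \mathbf{G}\varphi \mid \varphi\mathbf{U}\varphi \mid \varphi\mathbf{W}\varphi \mid \varphi\mathbf{M}\varphi \mid \varphi\mathbf{R}\varphi$ with $a \in Ap$. For an infinite word $w = w[0]w[1]\cdots$ over $2^{Ap}$, $w_i$ is the suffix $w[i]w[i+1]\cdots$ and $w_{ij}$ is the finite infix $w[i]\cdots w[j-1]$. Semantics: standard for $\mathbf{tt},\mathbf{ff},a,\neg a,\wedge,\vee$; $w\models\mathbf{X}\varphi$ iff $w_1\models\varphi$; $w\models\mathbf{F}\varphi$ iff $\exists k.\,w_k\models\varphi$; $w\models\mathbf{G}\varphi$ iff $\forall k.\,w_k\models\varphi$; $w\models\varphi\mathbf{U}\psi$ iff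 $\exists k.\,w_k\models\psi$ and $\forall j<k.\,w_j\models\varphi$; $w\models\varphi\mathbf{W}\psi$ iff $w\models\mathbf{G}\varphi$ or $w\models\varphi\mathbf{U}\psi$; $w\models\varphi\mathbf{M}\psi$ iff $\exists k.\,w_k\models\varphi$ and $\forall j\le k.\,w_j\models\psi$; $w\models\varphi\mathbf{R}\psi$ iff $w\models\mathbf{G}\psi$ or $w\models\varphi\mathbf{M}\psi$. The function $\mathit{af}$ ("after"): for a letter $\nu\in 2^{Ap}$, $\mathit{af}(a,\nu)=\mathbf{tt}$ if $a\in\nu$ and $\mathbf{ff}$ otherwise; $\mathit{af}(\neg a,\nu)=\mathbf{ff}$ if $a\in\nu$ and $\mathbf{tt}$ otherwise; $\mathit{af}(\mathbf{tt},\nu)=\mathbf{tt}$, $\mathit{af}(\mathbf{ff},\nu)=\mathbf{ff}$; $\mathit{af}$ commutes with $\wedge,\vee$; $\mathit{af}(\mathbf{X}\varphi,\nu)=\varphi$; $\mathit{af}(\mathbf{F}\varphi,\nu)=\mathit{af}(\varphi,\nu)\vee\mathbf{F}\varphi$; $\mathit{af}(\mathbf{G}\varphi,\nu)=\mathit{af}(\varphi,\nu)\wedge\mathbf{G}\varphi$; $\mathit{af}(\varphi\mathbf{U}\psi,\nu)=\mathit{af}(\psi,\nu)\vee(\mathit{af}(\varphi,\nu)\wedge\varphi\mathbf{U}\psi)$; same shape for $\mathbf{W}$; $\mathit{af}(\varphi\mathbf{M}\psi,\nu)=\mathit{af}(\psi,\nu)\wedge(\mathit{af}(\varphi,\nu)\vee\varphi\mathbf{M}\psi)$;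 same shape for $\mathbf{R}$. Extended to finite words by $\mathit{af}(\varphi,\epsilon)=\varphi$, $\mathit{af}(\varphi,\nu u)=\mathit{af}(\mathit{af}(\varphi,\nu),u)$. $\mu(\varphi)$ is the set of subformulas of $\varphi$ of the form $\mathbf{F}\psi$, $\psi_1\mathbf{U}\psi_2$, $\psi_1\mathbf{M}\psi_2$; $\nu(\varphi)$ is the set of subformulas of the form $\mathbf{G}\psi$, $\psi_1\mathbf{W}\psi_2$, $\psi_1\mathbf{R}\psi_2$. For a set $X$ of formulas, $\psi[X]_\nu$ is defined inductively: it is $\psi$ for $\psi\in\{\mathbf{tt},\mathbf{ff},a,\neg a\}$; it commutes with $\mathbf{X},\mathbf{G},\wedge,\vee,\mathbf{W},\mathbf{R}$ (e.g. $(\psi_1\mathbf{W}\psi_2)[X]_\nu=(\psi_1[X]_\nu)\mathbf{W}(\psi_2[X]_\nu)$); $(\mathbf{F}\psi)[X]_\nu=\mathbf{tt}$ if $\mathbf{F}\psi\in X$ and $\mathbf{ff}$ otherwise; $(\psi_1\mathbf{U}\psi_2)[X]_\nu=(\psi_1[X]_\nu)\mathbf{W}(\psi_2[X]_\nu)$ if $\psi_1\mathbf{U}\psi_2\in X$ and $\mathbf{ff}$ otherwise; $(\psi_1\mathbf{M}\psi_2)[X]_\nu=(\psi_1[X]_\nu)\mathbf{R}(\psi_2[X]_\nu)$ if $\psi_1\mathbf{M}\psi_2\in X$ and $\mathbf{ff}$ otherwise. Dually, for a set $Y$ of formulas, $\psi[Y]_\mu$: it is $\psi$ for $\psi\in\{\mathbf{tt},\mathbf{ff},a,\neg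 a\}$; it commutes with $\mathbf{X},\mathbf{F},\wedge,\vee,\mathbf{U},\mathbf{M}$; $(\mathbf{G}\psi)[Y]_\mu=\mathbf{tt}$ if $\mathbf{G}\psi\in Y$ and $\mathbf{ff}$ otherwise; $(\psi_1\mathbf{W}\psi_2)[Y]_\mu=\mathbf{tt}$ if $\psi_1\mathbf{W}\psi_2\in Y$ and $(\psi_1[Y]_\mu)\mathbf{U}(\psi_2[Y]_\mu)$ otherwise; $(\psi_1\mathbf{R}\psi_2)[Y]_\mu=\mathbf{tt}$ if $\psi_1\mathbf{R}\psi_2\in Y$ and $(\psi_1[Y]_\mu)\mathbf{M}(\psi_2[Y]_\mu)$ otherwise. -}

module Defs where

open import Data.Nat using (ℕ; zero; suc; _+_; _<_; _≤_)
open import Data.Bool using (Bool; true; false; if_then_else_)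
open import Data.Fin using (Fin)
open import Data.Fin.Subset using (Subset)
open import Data.Vec using (lookup)
open import Data.List using (List; []; _∷_; _++_)
open import Data.Product using (Σ; _×_; _,_)
open import Data.Sum using (_⊎_)
open import Relation.Binary.PropositionalEquality using (_≡_)

Letter : ℕ → Set
Letter n = Subset n

Word : ℕ → Set
Word n = ℕ → Letter n

suffix : ∀ {n} → Word n → ℕ → Word n
suffix w k i = w (k + i)

infixr 30 _∧_ _∨_
infixr 40 _U_ _W_ _M_ _R_
infix 50 X_ F_ G_

data Formula (n : ℕ) : Set where
  tt ff : Formula n
  var nvar : Fin n → Formula n
  _∧_ _∨_ : Formula n → Formula n → Formula n
  X_ F_ G_ : Formula n → Formula n
  _U_ _W_ _M_ _R_ : Formula n → Formula n → Formula n

infix 10 _⊨_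
_⊨_ : ∀ {n} → Word n → Formula n → Set
w ⊨ tt = Data.Unit.⊤ where import Data.Unit
w ⊨ ff = Data.Empty.⊥ where import Data.Empty
w ⊨ var a = lookup (w 0) a ≡ true
w ⊨ nvar a = lookup (w 0) a ≡ false
w ⊨ φ ∧ ψ = (w ⊨ φ) × (w ⊨ ψ)
w ⊨ φ ∨ ψ = (w ⊨ φ) ⊎ (w ⊨ ψ)
w ⊨ X φ = suffix w 1 ⊨ φ
w ⊨ F φ = Σ ℕ λ k → suffix w k ⊨ φ
w ⊨ G φ = (k : ℕ) → suffix w k ⊨ φ
w ⊨ φ U ψ = Σ ℕ λ k → (suffix w k ⊨ ψ) × ((j : ℕ) → j < k → suffix w j ⊨ φ)
w ⊨ φ W ψ = ((k : ℕ) → suffix w k ⊨ φ)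
          ⊎ (Σ ℕ λ k → (suffix w k ⊨ ψ) × ((j : ℕ) → j < k → suffix w j ⊨ φ))
w ⊨ φ M ψ = Σ ℕ λ k → (suffix w k ⊨ φ) × ((j : ℕ) → j ≤ k → suffix w j ⊨ ψ)
w ⊨ φ R ψ = ((k : ℕ) → suffix w k ⊨ ψ)
          ⊎ (Σ ℕ λ k → (suffix w k ⊨ φ) × ((j : ℕ) → j ≤ k → suffix w j ⊨ ψ))

af : ∀ {n} → Formula n → Letter n → Formula n
af tt ν = tt
af ff ν = ff
af (var a) ν = if lookup ν a then tt else ff
af (nvar a) ν = if lookup ν a then ff else tt
af (φ ∧ ψ) ν = af φ ν ∧ af ψ ν
af (φ ∨ ψ) ν = af φ ν ∨ af ψ ν
af (X φ) ν = φ
af (F φ) ν = af φ ν ∨ F φ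
af (G φ) ν = af φ ν ∧ G φ
af (φ U ψ) ν = af ψ ν ∨ (af φ ν ∧ φ U ψ)
af (φ W ψ) ν = af ψ ν ∨ (af φ ν ∧ φ W ψ)
af (φ M ψ) ν = af ψ ν ∧ (af φ ν ∨ φ M ψ)
af (φ R ψ) ν = af ψ ν ∧ (af φ ν ∨ φ R ψ)

-- af extended to the finite prefix w_{0i} = w[0]...w[i-1]:
-- afPrefix φ w i = af(φ, w_{0i})
afPrefix : ∀ {n} → Formula n → Word n → ℕ → Formula n
afPrefix φ w zero = φ
afPrefix φ w (suc i) = afPrefix (af φ (w 0)) (suffix w 1) i

μ : ∀ {n} → Formula n → List (Formula n)
μ tt = []
μ ff = []
μ (var a) = []
μ (nvar a) = []
μ (φ ∧ ψ) = μ φ ++ μ ψ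
μ (φ ∨ ψ) = μ φ ++ μ ψ
μ (X φ) = μ φ
μ (F φ) = F φ ∷ μ φ
μ (G φ) = μ φ
μ (φ U ψ) = (φ U ψ) ∷ (μ φ ++ μ ψ)
μ (φ W ψ) = μ φ ++ μ ψ
μ (φ M ψ) = (φ M ψ) ∷ (μ φ ++ μ ψ)
μ (φ R ψ) = μ φ ++ μ ψ

ν : ∀ {n} → Formula n → List (Formula n)
ν tt = []
ν ff = []
ν (var a) = []
ν (nvar a) = []
ν (φ ∧ ψ) = ν φ ++ ν ψ
ν (φ ∨ ψ) = ν φ ++ ν ψ
ν (X φ) = ν φ
ν (F φ) = ν φ
ν (G φ) = G φ ∷ ν φ
ν (φ U ψ) = ν φ ++ ν ψ
ν (φ W ψ) = (φ W ψ) ∷ (ν φ ++ ν ψ)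
ν (φ M ψ) = ν φ ++ ν ψ
ν (φ R ψ) = (φ R ψ) ∷ (ν φ ++ ν ψ)

FSet : ℕ → Set
FSet n = Formula n → Bool

_[_]ν : ∀ {n} → Formula n → FSet n → Formula n
tt [ S ]ν = tt
ff [ S ]ν = ff
var a [ S ]ν = var a
nvar a [ S ]ν = nvar a
(φ ∧ ψ) [ S ]ν = (φ [ S ]ν) ∧ (ψ [ S ]ν)
(φ ∨ ψ) [ S ]ν = (φ [ S ]ν) ∨ (ψ [ S ]ν)
(X φ) [ S ]ν = X (φ [ S ]ν)
(G φ) [ S ]ν = G (φ [ S ]ν)
(φ W ψ) [ S ]ν = (φ [ S ]ν) W (ψ [ S ]ν)
(φ R ψ) [ S ]ν = (φ [ S ]ν) R (ψ [ S ]ν)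
(F φ) [ S ]ν = if S (F φ) then tt else ff
(φ U ψ) [ S ]ν = if S (φ U ψ) then (φ [ S ]ν) W (ψ [ S ]ν) else ff
(φ M ψ) [ S ]ν = if S (φ M ψ) then (φ [ S ]ν) R (ψ [ S ]ν) else ff

_[_]μ : ∀ {n} → Formula n → FSet n → Formula n
tt [ S ]μ = tt
ff [ S ]μ = ff
var a [ S ]μ = var a
nvar a [ S ]μ = nvar a
(φ ∧ ψ) [ S ]μ = (φ [ S ]μ) ∧ (ψ [ S ]μ)
(φ ∨ ψ) [ S ]μ = (φ [ S ]μ) ∨ (ψ [ S ]μ)
(X φ) [ S ]μ = X (φ [ S ]μ)
(F φ) [ S ]μ = F (φ [ S ]μ)
(φ U ψ) [ S ]μ = (φ [ S ]μ) U (ψ [ S ]μ)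
(φ M ψ) [ S ]μ = (φ [ S ]μ) M (ψ [ S ]μ)
(G φ) [ S ]μ = if S (G φ) then tt else ff
(φ W ψ) [ S ]μ = if S (φ W ψ) then tt else (φ [ S ]μ) U (ψ [ S ]μ)
(φ R ψ) [ S ]μ = if S (φ R ψ) then tt else (φ [ S ]μ) M (ψ [ S ]μ)

-- By af, w ⊨ φ iff w_i ⊨ φ_i, for any i. Take for X the μ-subformulas of φ that hold
-- infinitely often and for Y the ν-subformulas that eventually hold forever (a choice that
-- needs excluded middle), and let K be a position after which the other μ-subformulas never
-- hold and every member of Y holds forever; then φ_K[X]_ν holds at w_K, and (2), (3)
-- follow in the same way.
-- Conversely, ψ[X]_ν implies ψ once every member of X holds infinitely often, and ψ[Y]_μ
-- implies ψ once every member of Y eventually holds forever. Through (2) and (3) these two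
-- facts justify each other on smaller subformulas, so induction on formulas establishes
-- them for all of X and Y, and (1) then gives w_i ⊨ φ_i.
module Submission where

open import Defs
open import Axiom.DoubleNegationElimination using (em⇒dne)
open import Axiom.ExcludedMiddle using (ExcludedMiddle)
open import Data.Bool using (true; false)
open import Data.Bool.Properties using () renaming (_≟_ to _≟ᵇ_)
open import Data.Empty using (⊥-elim)
open import Data.List using (List; _++_)
open import Data.List.Membership.Propositional using (_∈_)
open import Data.List.Relation.Unary.All as All using (All; []; _∷_)
open import Data.List.Relation.Unary.All.Properties using (++⁺; ++⁻ˡ; ++⁻ʳ)
open import Data.Nat using (ℕ; zero; suc; _+_; _∸_; _≤_; _⊔_; z≤n; s≤s)
open import Data.Nat.Properties using (+-assoc; m+[n∸m]≡n; m≤m+n; m≤n+m; m≤m⊔n; m≤n⊔m; ≤-refl; ≤-trans)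
open import Data.Product using (Σ; _×_; _,_; proj₁; proj₂; ∃-syntax; uncurry)
open import Data.Sum using (inj₁; inj₂)
open import Data.Unit using () renaming (tt to ⋆)
open import Data.Vec using (lookup)
open import Function using (_∘_)
open import Function.Bundles using (_⇔_; mk⇔)
open import Level using (0ℓ)
open import Relation.Binary.PropositionalEquality using (_≡_; _≗_; refl; sym; trans; cong; subst)
open import Relation.Nullary using (Dec; yes; no; ¬_; does; proof; contradiction)
open import Relation.Nullary.Decidable using (dec-true)
open import Relation.Nullary.Negation using (¬∃⟶∀¬)
open import Relation.Nullary.Reflects using (Reflects; invert)

private
  variable
    n : ℕ

suffix-resp-≗ : {w v : Word n} → w ≗ v → ∀ k → suffix w k ≗ suffix v k
suffix-resp-≗ w≗v k i = w≗v (k + i)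

⊨-resp-≗ : ∀ (φ : Formula n) {w v : Word n} → w ≗ v → w ⊨ φ → v ⊨ φ
⊨-resp-≗ tt e p = p
⊨-resp-≗ ff e p = p
⊨-resp-≗ (var a) e p = subst (λ l → lookup l a ≡ true) (e 0) p
⊨-resp-≗ (nvar a) e p = subst (λ l → lookup l a ≡ false) (e 0) p
⊨-resp-≗ (φ ∧ ψ) e (p , q) = ⊨-resp-≗ φ e p , ⊨-resp-≗ ψ e q
⊨-resp-≗ (φ ∨ ψ) e (inj₁ p) = inj₁ (⊨-resp-≗ φ e p)
⊨-resp-≗ (φ ∨ ψ) e (inj₂ q) = inj₂ (⊨-resp-≗ ψ e q)
⊨-resp-≗ (X φ) e p = ⊨-resp-≗ φ (suffix-resp-≗ e 1) p
⊨-resp-≗ (F φ) e (k , p) = k , ⊨-resp-≗ φ (suffix-resp-≗ e k) p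
⊨-resp-≗ (G φ) e p k = ⊨-resp-≗ φ (suffix-resp-≗ e k) (p k)
⊨-resp-≗ (φ U ψ) e (k , q , r) =
  k , ⊨-resp-≗ ψ (suffix-resp-≗ e k) q , λ j j<k → ⊨-resp-≗ φ (suffix-resp-≗ e j) (r j j<k)
⊨-resp-≗ (φ W ψ) e (inj₁ g) = inj₁ λ k → ⊨-resp-≗ φ (suffix-resp-≗ e k) (g k)
⊨-resp-≗ (φ W ψ) e (inj₂ (k , q , r)) =
  inj₂ (k , ⊨-resp-≗ ψ (suffix-resp-≗ e k) q , λ j j<k → ⊨-resp-≗ φ (suffix-resp-≗ e j) (r j j<k))
⊨-resp-≗ (φ M ψ) e (k , q , r) =
  k , ⊨-resp-≗ φ (suffix-resp-≗ e k) q , λ j j≤k → ⊨-resp-≗ ψ (suffix-resp-≗ e j) (r j j≤k)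
⊨-resp-≗ (φ R ψ) e (inj₁ g) = inj₁ λ k → ⊨-resp-≗ ψ (suffix-resp-≗ e k) (g k)
⊨-resp-≗ (φ R ψ) e (inj₂ (k , q , r)) =
  inj₂ (k , ⊨-resp-≗ φ (suffix-resp-≗ e k) q , λ j j≤k → ⊨-resp-≗ ψ (suffix-resp-≗ e j) (r j j≤k))

suffix-+ : ∀ (w : Word n) a b → suffix (suffix w a) b ≗ suffix w (a + b)
suffix-+ w a b i = cong w (sym (+-assoc a b i))

⊨-suffix-+⁺ : ∀ (φ : Formula n) w a b → suffix (suffix w a) b ⊨ φ → suffix w (a + b) ⊨ φ
⊨-suffix-+⁺ φ w a b = ⊨-resp-≗ φ (suffix-+ w a b)

⊨-suffix-+⁻ : ∀ (φ : Formula n) w a b → suffix w (a + b) ⊨ φ → suffix (suffix w a) b ⊨ φ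
⊨-suffix-+⁻ φ w a b = ⊨-resp-≗ φ (sym ∘ suffix-+ w a b)

⊨-suffix-reindex : ∀ (φ : Formula n) w a b c d → a + b ≡ c + d →
                   suffix (suffix w a) b ⊨ φ → suffix (suffix w c) d ⊨ φ
⊨-suffix-reindex φ w a b c d eq =
  ⊨-suffix-+⁻ φ w c d ∘ subst (λ k → suffix w k ⊨ φ) eq ∘ ⊨-suffix-+⁺ φ w a b

k+[m∸k+j]≡m+j : ∀ {k m} j → k ≤ m → k + ((m ∸ k) + j) ≡ m + j
k+[m∸k+j]≡m+j {k} {m} j k≤m =
  trans (sym (+-assoc k (m ∸ k) j)) (cong (_+ j) (m+[n∸m]≡n k≤m))

G-suffix : ∀ (φ : Formula n) w k → w ⊨ G φ → suffix w k ⊨ G φ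
G-suffix φ w k g j = ⊨-suffix-+⁻ φ w k j (g (k + j))

G-mono : ∀ (φ : Formula n) w {k m} → k ≤ m → suffix w k ⊨ G φ → suffix w m ⊨ G φ
G-mono φ w {k} {m} k≤m g j =
  ⊨-suffix-reindex φ w k ((m ∸ k) + j) m j (k+[m∸k+j]≡m+j j k≤m) (g ((m ∸ k) + j))

F-from-suffix : ∀ (φ : Formula n) w k → suffix w k ⊨ F φ → w ⊨ F φ
F-from-suffix φ w k (j , p) = k + j , ⊨-suffix-+⁺ φ w k j p

F-antitone : ∀ (φ : Formula n) w {k m} → k ≤ m → suffix w m ⊨ F φ → suffix w k ⊨ F φ
F-antitone φ w {k} {m} k≤m (j , p) =
  (m ∸ k) + j , ⊨-suffix-reindex φ w m j k ((m ∸ k) + j) (sym (k+[m∸k+j]≡m+j j k≤m)) p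

G∧FU⇒U : ∀ (φ ψ : Formula n) w → w ⊨ G φ → w ⊨ F (φ U ψ) → w ⊨ φ U ψ
G∧FU⇒U φ ψ w g (j , k , q , _) = j + k , ⊨-suffix-+⁺ ψ w j k q , λ i _ → g i

G∧FM⇒M : ∀ (φ ψ : Formula n) w → w ⊨ G ψ → w ⊨ F (φ M ψ) → w ⊨ φ M ψ
G∧FM⇒M φ ψ w g (j , k , q , _) = j + k , ⊨-suffix-+⁺ φ w j k q , λ i _ → g i

Eventually : (ℕ → Set) → Set
Eventually P = ∃[ K ] (∀ m → K ≤ m → P m)

eventually-map : ∀ {P Q : ℕ → Set} → (∀ {m} → P m → Q m) → Eventually P → Eventually Q
eventually-map f (K , p) = K , λ m K≤m → f (p m K≤m)

eventually-× : ∀ {P Q : ℕ → Set} → Eventually P → Eventually Q → Eventually (λ m → P m × Q m)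
eventually-× (K , p) (L , q) =
  K ⊔ L , λ m K⊔L≤m → p m (≤-trans (m≤m⊔n K L) K⊔L≤m) , q m (≤-trans (m≤n⊔m K L) K⊔L≤m)

eventually-All : ∀ {A : Set} {Q : A → ℕ → Set} {xs : List A} →
                 All (λ x → Eventually (Q x)) xs → Eventually (λ m → All (λ x → Q x m) xs)
eventually-All [] = 0 , λ _ _ → []
eventually-All (e ∷ es) = eventually-map (uncurry _∷_) (eventually-× e (eventually-All es))

eventually-⇒ : ∀ {A : Set} {P : ℕ → Set} → Dec A → (A → Eventually P) → Eventually (λ m → A → P m)
eventually-⇒ (yes a) f = eventually-map (λ p _ → p) (f a)
eventually-⇒ (no ¬a) f = 0 , λ _ _ a → contradiction a ¬a

FG⇒eventually-G : ∀ (φ : Formula n) w → w ⊨ F (G φ) → Eventually (λ m → suffix w m ⊨ G φ)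
FG⇒eventually-G φ w (k , g) = k , λ m k≤m → G-mono φ w k≤m g

eventually-F⇒GF : ExcludedMiddle 0ℓ → ∀ (φ : Formula n) w →
                  Eventually (λ m → suffix w m ⊨ F φ → w ⊨ G (F φ))
eventually-F⇒GF em φ w with em {∃[ k ] ¬ (suffix w k ⊨ F φ)}
... | yes (k , ¬Fk) = k , λ m k≤m Fm → contradiction (F-antitone φ w k≤m Fm) ¬Fk
... | no ¬∃ = 0 , λ _ _ _ k → em⇒dne em (¬∃⟶∀¬ ¬∃ k)

-- The after function

⊨-af⁺ : ∀ (φ : Formula n) w → w ⊨ φ → suffix w 1 ⊨ af φ (w 0)
⊨-af⁺ tt w p = p
⊨-af⁺ ff w p = p
⊨-af⁺ (var a) w p rewrite p = ⋆
⊨-af⁺ (nvar a) w p rewrite p = ⋆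
⊨-af⁺ (φ ∧ ψ) w (p , q) = ⊨-af⁺ φ w p , ⊨-af⁺ ψ w q
⊨-af⁺ (φ ∨ ψ) w (inj₁ p) = inj₁ (⊨-af⁺ φ w p)
⊨-af⁺ (φ ∨ ψ) w (inj₂ q) = inj₂ (⊨-af⁺ ψ w q)
⊨-af⁺ (X φ) w p = p
⊨-af⁺ (F φ) w (zero , p) = inj₁ (⊨-af⁺ φ w p)
⊨-af⁺ (F φ) w (suc k , p) = inj₂ (k , p)
⊨-af⁺ (G φ) w g = ⊨-af⁺ φ w (g 0) , λ k → g (suc k)
⊨-af⁺ (φ U ψ) w (zero , q , r) = inj₁ (⊨-af⁺ ψ w q)
⊨-af⁺ (φ U ψ) w (suc k , q , r) =
  inj₂ (⊨-af⁺ φ w (r 0 (s≤s z≤n)) , k , q , λ j j<k → r (suc j) (s≤s j<k))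
⊨-af⁺ (φ W ψ) w (inj₁ g) = inj₂ (⊨-af⁺ φ w (g 0) , inj₁ λ k → g (suc k))
⊨-af⁺ (φ W ψ) w (inj₂ (zero , q , r)) = inj₁ (⊨-af⁺ ψ w q)
⊨-af⁺ (φ W ψ) w (inj₂ (suc k , q , r)) =
  inj₂ (⊨-af⁺ φ w (r 0 (s≤s z≤n)) , inj₂ (k , q , λ j j<k → r (suc j) (s≤s j<k)))
⊨-af⁺ (φ M ψ) w (zero , q , r) = ⊨-af⁺ ψ w (r 0 z≤n) , inj₁ (⊨-af⁺ φ w q)
⊨-af⁺ (φ M ψ) w (suc k , q , r) =
  ⊨-af⁺ ψ w (r 0 z≤n) , inj₂ (k , q , λ j j≤k → r (suc j) (s≤s j≤k))
⊨-af⁺ (φ R ψ) w (inj₁ g) = ⊨-af⁺ ψ w (g 0) , inj₂ (inj₁ λ k → g (suc k))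
⊨-af⁺ (φ R ψ) w (inj₂ (zero , q , r)) = ⊨-af⁺ ψ w (r 0 z≤n) , inj₁ (⊨-af⁺ φ w q)
⊨-af⁺ (φ R ψ) w (inj₂ (suc k , q , r)) =
  ⊨-af⁺ ψ w (r 0 z≤n) , inj₂ (inj₂ (k , q , λ j j≤k → r (suc j) (s≤s j≤k)))

⊨-af⁻ : ∀ (φ : Formula n) w → suffix w 1 ⊨ af φ (w 0) → w ⊨ φ
⊨-af⁻ tt w p = p
⊨-af⁻ ff w p = p
⊨-af⁻ (var a) w p with lookup (w 0) a
... | true = refl
... | false = ⊥-elim p
⊨-af⁻ (nvar a) w p with lookup (w 0) a
... | true = ⊥-elim p
... | false = refl
⊨-af⁻ (φ ∧ ψ) w (p , q) = ⊨-af⁻ φ w p , ⊨-af⁻ ψ w q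
⊨-af⁻ (φ ∨ ψ) w (inj₁ p) = inj₁ (⊨-af⁻ φ w p)
⊨-af⁻ (φ ∨ ψ) w (inj₂ q) = inj₂ (⊨-af⁻ ψ w q)
⊨-af⁻ (X φ) w p = p
⊨-af⁻ (F φ) w (inj₁ p) = 0 , ⊨-af⁻ φ w p
⊨-af⁻ (F φ) w (inj₂ (k , p)) = suc k , p
⊨-af⁻ (G φ) w (p , g) zero = ⊨-af⁻ φ w p
⊨-af⁻ (G φ) w (p , g) (suc k) = g k
⊨-af⁻ (φ U ψ) w (inj₁ q) = 0 , ⊨-af⁻ ψ w q , λ _ ()
⊨-af⁻ (φ U ψ) w (inj₂ (p , k , q , r)) =
  suc k , q , λ { zero _ → ⊨-af⁻ φ w p ; (suc j) (s≤s j<k) → r j j<k }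
⊨-af⁻ (φ W ψ) w (inj₁ q) = inj₂ (0 , ⊨-af⁻ ψ w q , λ _ ())
⊨-af⁻ (φ W ψ) w (inj₂ (p , inj₁ g)) = inj₁ λ { zero → ⊨-af⁻ φ w p ; (suc k) → g k }
⊨-af⁻ (φ W ψ) w (inj₂ (p , inj₂ (k , q , r))) =
  inj₂ (suc k , q , λ { zero _ → ⊨-af⁻ φ w p ; (suc j) (s≤s j<k) → r j j<k })
⊨-af⁻ (φ M ψ) w (q , inj₁ p) = 0 , ⊨-af⁻ φ w p , λ { zero _ → ⊨-af⁻ ψ w q }
⊨-af⁻ (φ M ψ) w (q , inj₂ (k , p , r)) =
  suc k , p , λ { zero _ → ⊨-af⁻ ψ w q ; (suc j) (s≤s j≤k) → r j j≤k }
⊨-af⁻ (φ R ψ) w (q , inj₁ p) = inj₂ (0 , ⊨-af⁻ φ w p , λ { zero _ → ⊨-af⁻ ψ w q })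
⊨-af⁻ (φ R ψ) w (q , inj₂ (inj₁ g)) = inj₁ λ { zero → ⊨-af⁻ ψ w q ; (suc k) → g k }
⊨-af⁻ (φ R ψ) w (q , inj₂ (inj₂ (k , p , r))) =
  inj₂ (suc k , p , λ { zero _ → ⊨-af⁻ ψ w q ; (suc j) (s≤s j≤k) → r j j≤k })

⊨-afPrefix⁺ : ∀ (φ : Formula n) w i → w ⊨ φ → suffix w i ⊨ afPrefix φ w i
⊨-afPrefix⁺ φ w zero p = p
⊨-afPrefix⁺ φ w (suc i) p = ⊨-afPrefix⁺ (af φ (w 0)) (suffix w 1) i (⊨-af⁺ φ w p)

⊨-afPrefix⁻ : ∀ (φ : Formula n) w i → suffix w i ⊨ afPrefix φ w i → w ⊨ φ
⊨-afPrefix⁻ φ w zero p = p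
⊨-afPrefix⁻ φ w (suc i) p = ⊨-af⁻ φ w (⊨-afPrefix⁻ (af φ (w 0)) (suffix w 1) i p)

-- Subformula closure of μ and ν

module _ {n} {P : Formula n → Set} where

  private
    All-++-map : ∀ {Q : Formula n → Set} {xs xs′ ys ys′} →
                 (All P xs → All Q ys) → (All P xs′ → All Q ys′) →
                 All P (xs ++ xs′) → All Q (ys ++ ys′)
    All-++-map {xs = xs} f g h = ++⁺ (f (++⁻ˡ xs h)) (g (++⁻ʳ xs h))

  μ-af : ∀ (φ : Formula n) l → All P (μ φ) → All P (μ (af φ l))
  μ-af tt l h = h
  μ-af ff l h = h
  μ-af (var a) l h with lookup l a
  ... | true = []
  ... | false = []
  μ-af (nvar a) l h with lookup l a
  ... | true = []
  ... | false = []
  μ-af (φ ∧ ψ) l = All-++-map (μ-af φ l) (μ-af ψ l)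
  μ-af (φ ∨ ψ) l = All-++-map (μ-af φ l) (μ-af ψ l)
  μ-af (X φ) l h = h
  μ-af (F φ) l h@(_ ∷ hφ) = ++⁺ (μ-af φ l hφ) h
  μ-af (G φ) l h = ++⁺ (μ-af φ l h) h
  μ-af (φ U ψ) l h@(_ ∷ hφψ) =
    ++⁺ (μ-af ψ l (++⁻ʳ (μ φ) hφψ)) (++⁺ (μ-af φ l (++⁻ˡ (μ φ) hφψ)) h)
  μ-af (φ W ψ) l h = ++⁺ (μ-af ψ l (++⁻ʳ (μ φ) h)) (++⁺ (μ-af φ l (++⁻ˡ (μ φ) h)) h)
  μ-af (φ M ψ) l h@(_ ∷ hφψ) =
    ++⁺ (μ-af ψ l (++⁻ʳ (μ φ) hφψ)) (++⁺ (μ-af φ l (++⁻ˡ (μ φ) hφψ)) h)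
  μ-af (φ R ψ) l h = ++⁺ (μ-af ψ l (++⁻ʳ (μ φ) h)) (++⁺ (μ-af φ l (++⁻ˡ (μ φ) h)) h)

  μ-afPrefix : ∀ (φ : Formula n) w i → All P (μ φ) → All P (μ (afPrefix φ w i))
  μ-afPrefix φ w zero h = h
  μ-afPrefix φ w (suc i) h = μ-afPrefix (af φ (w 0)) (suffix w 1) i (μ-af φ (w 0) h)

  ν-of-μ : ∀ (φ : Formula n) → All P (ν φ) → All (λ χ → All P (ν χ)) (μ φ)
  ν-of-μ tt h = []
  ν-of-μ ff h = []
  ν-of-μ (var a) h = []
  ν-of-μ (nvar a) h = []
  ν-of-μ (φ ∧ ψ) = All-++-map (ν-of-μ φ) (ν-of-μ ψ)
  ν-of-μ (φ ∨ ψ) = All-++-map (ν-of-μ φ) (ν-of-μ ψ)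
  ν-of-μ (X φ) = ν-of-μ φ
  ν-of-μ (F φ) h = h ∷ ν-of-μ φ h
  ν-of-μ (G φ) (_ ∷ h) = ν-of-μ φ h
  ν-of-μ (φ U ψ) h = h ∷ All-++-map (ν-of-μ φ) (ν-of-μ ψ) h
  ν-of-μ (φ W ψ) (_ ∷ h) = All-++-map (ν-of-μ φ) (ν-of-μ ψ) h
  ν-of-μ (φ M ψ) h = h ∷ All-++-map (ν-of-μ φ) (ν-of-μ ψ) h
  ν-of-μ (φ R ψ) (_ ∷ h) = All-++-map (ν-of-μ φ) (ν-of-μ ψ) h

  μ-of-ν : ∀ (φ : Formula n) → All P (μ φ) → All (λ χ → All P (μ χ)) (ν φ)
  μ-of-ν tt h = []
  μ-of-ν ff h = []
  μ-of-ν (var a) h = []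
  μ-of-ν (nvar a) h = []
  μ-of-ν (φ ∧ ψ) = All-++-map (μ-of-ν φ) (μ-of-ν ψ)
  μ-of-ν (φ ∨ ψ) = All-++-map (μ-of-ν φ) (μ-of-ν ψ)
  μ-of-ν (X φ) = μ-of-ν φ
  μ-of-ν (F φ) (_ ∷ h) = μ-of-ν φ h
  μ-of-ν (G φ) h = h ∷ μ-of-ν φ h
  μ-of-ν (φ U ψ) (_ ∷ h) = All-++-map (μ-of-ν φ) (μ-of-ν ψ) h
  μ-of-ν (φ W ψ) h = h ∷ All-++-map (μ-of-ν φ) (μ-of-ν ψ) h
  μ-of-ν (φ M ψ) (_ ∷ h) = All-++-map (μ-of-ν φ) (μ-of-ν ψ) h
  μ-of-ν (φ R ψ) h = h ∷ All-++-map (μ-of-ν φ) (μ-of-ν ψ) h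

-- Substitutions

F⇒∈ ∈⇒GF FG⇒∈ ∈⇒G ∈⇒FG : FSet n → Word n → Formula n → Set
F⇒∈ S w c = w ⊨ F c → S c ≡ true
∈⇒GF S w c = S c ≡ true → w ⊨ G (F c)
FG⇒∈ S w c = w ⊨ F (G c) → S c ≡ true
∈⇒G S w c = S c ≡ true → w ⊨ G c
∈⇒FG S w c = S c ≡ true → w ⊨ F (G c)

F⇒∈-suffix : ∀ S (w : Word n) k {c} → F⇒∈ S w c → F⇒∈ S (suffix w k) c
F⇒∈-suffix S w k {c} h = h ∘ F-from-suffix c w k

∈⇒GF-suffix : ∀ S (w : Word n) k {c} → ∈⇒GF S w c → ∈⇒GF S (suffix w k) c
∈⇒GF-suffix S w k {c} h = G-suffix (F c) w k ∘ h

FG⇒∈-suffix : ∀ S (w : Word n) k {c} → FG⇒∈ S w c → FG⇒∈ S (suffix w k) c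
FG⇒∈-suffix S w k {c} h = h ∘ F-from-suffix (G c) w k

∈⇒G-suffix : ∀ S (w : Word n) k {c} → ∈⇒G S w c → ∈⇒G S (suffix w k) c
∈⇒G-suffix S w k {c} h = G-suffix c w k ∘ h

module _ {n} (S : FSet n) where

  private
    ↑ : ∀ w k {xs} → All (F⇒∈ S w) xs → All (F⇒∈ S (suffix w k)) xs
    ↑ w k = All.map (F⇒∈-suffix S w k)

  ⊨-[]ν⁺ : ∀ (ψ : Formula n) w → All (F⇒∈ S w) (μ ψ) → w ⊨ ψ → w ⊨ ψ [ S ]ν
  ⊨-[]ν⁺ tt w h p = p
  ⊨-[]ν⁺ ff w h p = p
  ⊨-[]ν⁺ (var a) w h p = p
  ⊨-[]ν⁺ (nvar a) w h p = p
  ⊨-[]ν⁺ (φ ∧ ψ) w h (p , q) = ⊨-[]ν⁺ φ w (++⁻ˡ (μ φ) h) p , ⊨-[]ν⁺ ψ w (++⁻ʳ (μ φ) h) q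
  ⊨-[]ν⁺ (φ ∨ ψ) w h (inj₁ p) = inj₁ (⊨-[]ν⁺ φ w (++⁻ˡ (μ φ) h) p)
  ⊨-[]ν⁺ (φ ∨ ψ) w h (inj₂ q) = inj₂ (⊨-[]ν⁺ ψ w (++⁻ʳ (μ φ) h) q)
  ⊨-[]ν⁺ (X φ) w h p = ⊨-[]ν⁺ φ (suffix w 1) (↑ w 1 h) p
  ⊨-[]ν⁺ (G φ) w h g k = ⊨-[]ν⁺ φ (suffix w k) (↑ w k h) (g k)
  ⊨-[]ν⁺ (F φ) w (h ∷ _) p rewrite h (0 , p) = ⋆
  ⊨-[]ν⁺ (φ U ψ) w (h ∷ hs) u@(k , q , r) rewrite h (0 , u) =
    inj₂ (k , ⊨-[]ν⁺ ψ (suffix w k) (↑ w k (++⁻ʳ (μ φ) hs)) q ,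
          λ j j<k → ⊨-[]ν⁺ φ (suffix w j) (↑ w j (++⁻ˡ (μ φ) hs)) (r j j<k))
  ⊨-[]ν⁺ (φ W ψ) w h (inj₁ g) = inj₁ λ k → ⊨-[]ν⁺ φ (suffix w k) (↑ w k (++⁻ˡ (μ φ) h)) (g k)
  ⊨-[]ν⁺ (φ W ψ) w h (inj₂ (k , q , r)) =
    inj₂ (k , ⊨-[]ν⁺ ψ (suffix w k) (↑ w k (++⁻ʳ (μ φ) h)) q ,
          λ j j<k → ⊨-[]ν⁺ φ (suffix w j) (↑ w j (++⁻ˡ (μ φ) h)) (r j j<k))
  ⊨-[]ν⁺ (φ M ψ) w (h ∷ hs) m@(k , q , r) rewrite h (0 , m) =
    inj₂ (k , ⊨-[]ν⁺ φ (suffix w k) (↑ w k (++⁻ˡ (μ φ) hs)) q ,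
          λ j j≤k → ⊨-[]ν⁺ ψ (suffix w j) (↑ w j (++⁻ʳ (μ φ) hs)) (r j j≤k))
  ⊨-[]ν⁺ (φ R ψ) w h (inj₁ g) = inj₁ λ k → ⊨-[]ν⁺ ψ (suffix w k) (↑ w k (++⁻ʳ (μ φ) h)) (g k)
  ⊨-[]ν⁺ (φ R ψ) w h (inj₂ (k , q , r)) =
    inj₂ (k , ⊨-[]ν⁺ φ (suffix w k) (↑ w k (++⁻ˡ (μ φ) h)) q ,
          λ j j≤k → ⊨-[]ν⁺ ψ (suffix w j) (↑ w j (++⁻ʳ (μ φ) h)) (r j j≤k))

module _ {n} (S : FSet n) where

  private
    ↑ : ∀ w k {xs} → All (∈⇒GF S w) xs → All (∈⇒GF S (suffix w k)) xs
    ↑ w k = All.map (∈⇒GF-suffix S w k)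

  ⊨-[]ν⁻ : ∀ (ψ : Formula n) w → All (∈⇒GF S w) (μ ψ) → w ⊨ ψ [ S ]ν → w ⊨ ψ
  ⊨-[]ν⁻ tt w h p = p
  ⊨-[]ν⁻ ff w h p = p
  ⊨-[]ν⁻ (var a) w h p = p
  ⊨-[]ν⁻ (nvar a) w h p = p
  ⊨-[]ν⁻ (φ ∧ ψ) w h (p , q) = ⊨-[]ν⁻ φ w (++⁻ˡ (μ φ) h) p , ⊨-[]ν⁻ ψ w (++⁻ʳ (μ φ) h) q
  ⊨-[]ν⁻ (φ ∨ ψ) w h (inj₁ p) = inj₁ (⊨-[]ν⁻ φ w (++⁻ˡ (μ φ) h) p)
  ⊨-[]ν⁻ (φ ∨ ψ) w h (inj₂ q) = inj₂ (⊨-[]ν⁻ ψ w (++⁻ʳ (μ φ) h) q)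
  ⊨-[]ν⁻ (X φ) w h p = ⊨-[]ν⁻ φ (suffix w 1) (↑ w 1 h) p
  ⊨-[]ν⁻ (G φ) w h g k = ⊨-[]ν⁻ φ (suffix w k) (↑ w k h) (g k)
  ⊨-[]ν⁻ (F φ) w (h ∷ _) p with S (F φ)
  ... | true = uncurry (F-from-suffix φ w) (h refl 0)
  ... | false = ⊥-elim p
  ⊨-[]ν⁻ (φ U ψ) w (h ∷ hs) p with S (φ U ψ)
  ⊨-[]ν⁻ (φ U ψ) w (h ∷ hs) p | false = ⊥-elim p
  ⊨-[]ν⁻ (φ U ψ) w (h ∷ hs) (inj₁ g) | true =
    G∧FU⇒U φ ψ w (λ k → ⊨-[]ν⁻ φ (suffix w k) (↑ w k (++⁻ˡ (μ φ) hs)) (g k)) (h refl 0)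
  ⊨-[]ν⁻ (φ U ψ) w (h ∷ hs) (inj₂ (k , q , r)) | true =
    k , ⊨-[]ν⁻ ψ (suffix w k) (↑ w k (++⁻ʳ (μ φ) hs)) q ,
    λ j j<k → ⊨-[]ν⁻ φ (suffix w j) (↑ w j (++⁻ˡ (μ φ) hs)) (r j j<k)
  ⊨-[]ν⁻ (φ W ψ) w h (inj₁ g) = inj₁ λ k → ⊨-[]ν⁻ φ (suffix w k) (↑ w k (++⁻ˡ (μ φ) h)) (g k)
  ⊨-[]ν⁻ (φ W ψ) w h (inj₂ (k , q , r)) =
    inj₂ (k , ⊨-[]ν⁻ ψ (suffix w k) (↑ w k (++⁻ʳ (μ φ) h)) q ,
          λ j j<k → ⊨-[]ν⁻ φ (suffix w j) (↑ w j (++⁻ˡ (μ φ) h)) (r j j<k))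
  ⊨-[]ν⁻ (φ M ψ) w (h ∷ hs) p with S (φ M ψ)
  ⊨-[]ν⁻ (φ M ψ) w (h ∷ hs) p | false = ⊥-elim p
  ⊨-[]ν⁻ (φ M ψ) w (h ∷ hs) (inj₁ g) | true =
    G∧FM⇒M φ ψ w (λ k → ⊨-[]ν⁻ ψ (suffix w k) (↑ w k (++⁻ʳ (μ φ) hs)) (g k)) (h refl 0)
  ⊨-[]ν⁻ (φ M ψ) w (h ∷ hs) (inj₂ (k , q , r)) | true =
    k , ⊨-[]ν⁻ φ (suffix w k) (↑ w k (++⁻ˡ (μ φ) hs)) q ,
    λ j j≤k → ⊨-[]ν⁻ ψ (suffix w j) (↑ w j (++⁻ʳ (μ φ) hs)) (r j j≤k)
  ⊨-[]ν⁻ (φ R ψ) w h (inj₁ g) = inj₁ λ k → ⊨-[]ν⁻ ψ (suffix w k) (↑ w k (++⁻ʳ (μ φ) h)) (g k)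
  ⊨-[]ν⁻ (φ R ψ) w h (inj₂ (k , q , r)) =
    inj₂ (k , ⊨-[]ν⁻ φ (suffix w k) (↑ w k (++⁻ˡ (μ φ) h)) q ,
          λ j j≤k → ⊨-[]ν⁻ ψ (suffix w j) (↑ w j (++⁻ʳ (μ φ) h)) (r j j≤k))

module _ {n} (S : FSet n) where

  private
    ↑ : ∀ w k {xs} → All (FG⇒∈ S w) xs → All (FG⇒∈ S (suffix w k)) xs
    ↑ w k = All.map (FG⇒∈-suffix S w k)

  ⊨-[]μ⁺ : ∀ (ψ : Formula n) w → All (FG⇒∈ S w) (ν ψ) → w ⊨ ψ → w ⊨ ψ [ S ]μ
  ⊨-[]μ⁺ tt w h p = p
  ⊨-[]μ⁺ ff w h p = p
  ⊨-[]μ⁺ (var a) w h p = p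
  ⊨-[]μ⁺ (nvar a) w h p = p
  ⊨-[]μ⁺ (φ ∧ ψ) w h (p , q) = ⊨-[]μ⁺ φ w (++⁻ˡ (ν φ) h) p , ⊨-[]μ⁺ ψ w (++⁻ʳ (ν φ) h) q
  ⊨-[]μ⁺ (φ ∨ ψ) w h (inj₁ p) = inj₁ (⊨-[]μ⁺ φ w (++⁻ˡ (ν φ) h) p)
  ⊨-[]μ⁺ (φ ∨ ψ) w h (inj₂ q) = inj₂ (⊨-[]μ⁺ ψ w (++⁻ʳ (ν φ) h) q)
  ⊨-[]μ⁺ (X φ) w h p = ⊨-[]μ⁺ φ (suffix w 1) (↑ w 1 h) p
  ⊨-[]μ⁺ (F φ) w h (k , p) = k , ⊨-[]μ⁺ φ (suffix w k) (↑ w k h) p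
  ⊨-[]μ⁺ (G φ) w (h ∷ _) g rewrite h (0 , λ j → G-suffix φ w j g) = ⋆
  ⊨-[]μ⁺ (φ U ψ) w h (k , q , r) =
    k , ⊨-[]μ⁺ ψ (suffix w k) (↑ w k (++⁻ʳ (ν φ) h)) q ,
    λ j j<k → ⊨-[]μ⁺ φ (suffix w j) (↑ w j (++⁻ˡ (ν φ) h)) (r j j<k)
  ⊨-[]μ⁺ (φ W ψ) w (h ∷ hs) (inj₁ g) rewrite h (0 , λ j → inj₁ (G-suffix φ w j g)) = ⋆
  ⊨-[]μ⁺ (φ W ψ) w (h ∷ hs) (inj₂ (k , q , r)) with S (φ W ψ)
  ... | true = ⋆
  ... | false = k , ⊨-[]μ⁺ ψ (suffix w k) (↑ w k (++⁻ʳ (ν φ) hs)) q ,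
                λ j j<k → ⊨-[]μ⁺ φ (suffix w j) (↑ w j (++⁻ˡ (ν φ) hs)) (r j j<k)
  ⊨-[]μ⁺ (φ M ψ) w h (k , q , r) =
    k , ⊨-[]μ⁺ φ (suffix w k) (↑ w k (++⁻ˡ (ν φ) h)) q ,
    λ j j≤k → ⊨-[]μ⁺ ψ (suffix w j) (↑ w j (++⁻ʳ (ν φ) h)) (r j j≤k)
  ⊨-[]μ⁺ (φ R ψ) w (h ∷ hs) (inj₁ g) rewrite h (0 , λ j → inj₁ (G-suffix ψ w j g)) = ⋆
  ⊨-[]μ⁺ (φ R ψ) w (h ∷ hs) (inj₂ (k , q , r)) with S (φ R ψ)
  ... | true = ⋆
  ... | false = k , ⊨-[]μ⁺ φ (suffix w k) (↑ w k (++⁻ˡ (ν φ) hs)) q ,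
                λ j j≤k → ⊨-[]μ⁺ ψ (suffix w j) (↑ w j (++⁻ʳ (ν φ) hs)) (r j j≤k)

module _ {n} (S : FSet n) where

  private
    ↑ : ∀ w k {xs} → All (∈⇒G S w) xs → All (∈⇒G S (suffix w k)) xs
    ↑ w k = All.map (∈⇒G-suffix S w k)

  ⊨-[]μ⁻ : ∀ (ψ : Formula n) w → All (∈⇒G S w) (ν ψ) → w ⊨ ψ [ S ]μ → w ⊨ ψ
  ⊨-[]μ⁻ tt w h p = p
  ⊨-[]μ⁻ ff w h p = p
  ⊨-[]μ⁻ (var a) w h p = p
  ⊨-[]μ⁻ (nvar a) w h p = p
  ⊨-[]μ⁻ (φ ∧ ψ) w h (p , q) = ⊨-[]μ⁻ φ w (++⁻ˡ (ν φ) h) p , ⊨-[]μ⁻ ψ w (++⁻ʳ (ν φ) h) q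
  ⊨-[]μ⁻ (φ ∨ ψ) w h (inj₁ p) = inj₁ (⊨-[]μ⁻ φ w (++⁻ˡ (ν φ) h) p)
  ⊨-[]μ⁻ (φ ∨ ψ) w h (inj₂ q) = inj₂ (⊨-[]μ⁻ ψ w (++⁻ʳ (ν φ) h) q)
  ⊨-[]μ⁻ (X φ) w h p = ⊨-[]μ⁻ φ (suffix w 1) (↑ w 1 h) p
  ⊨-[]μ⁻ (F φ) w h (k , p) = k , ⊨-[]μ⁻ φ (suffix w k) (↑ w k h) p
  ⊨-[]μ⁻ (G φ) w (h ∷ _) p with S (G φ)
  ... | true = λ k → h refl k 0
  ... | false = ⊥-elim p
  ⊨-[]μ⁻ (φ U ψ) w h (k , q , r) =
    k , ⊨-[]μ⁻ ψ (suffix w k) (↑ w k (++⁻ʳ (ν φ) h)) q ,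
    λ j j<k → ⊨-[]μ⁻ φ (suffix w j) (↑ w j (++⁻ˡ (ν φ) h)) (r j j<k)
  ⊨-[]μ⁻ (φ W ψ) w (h ∷ hs) p with S (φ W ψ)
  ⊨-[]μ⁻ (φ W ψ) w (h ∷ hs) p | true = h refl 0
  ⊨-[]μ⁻ (φ W ψ) w (h ∷ hs) (k , q , r) | false =
    inj₂ (k , ⊨-[]μ⁻ ψ (suffix w k) (↑ w k (++⁻ʳ (ν φ) hs)) q ,
          λ j j<k → ⊨-[]μ⁻ φ (suffix w j) (↑ w j (++⁻ˡ (ν φ) hs)) (r j j<k))
  ⊨-[]μ⁻ (φ M ψ) w h (k , q , r) =
    k , ⊨-[]μ⁻ φ (suffix w k) (↑ w k (++⁻ˡ (ν φ) h)) q ,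
    λ j j≤k → ⊨-[]μ⁻ ψ (suffix w j) (↑ w j (++⁻ʳ (ν φ) h)) (r j j≤k)
  ⊨-[]μ⁻ (φ R ψ) w (h ∷ hs) p with S (φ R ψ)
  ⊨-[]μ⁻ (φ R ψ) w (h ∷ hs) p | true = h refl 0
  ⊨-[]μ⁻ (φ R ψ) w (h ∷ hs) (k , q , r) | false =
    inj₂ (k , ⊨-[]μ⁻ φ (suffix w k) (↑ w k (++⁻ˡ (ν φ) hs)) q ,
          λ j j≤k → ⊨-[]μ⁻ ψ (suffix w j) (↑ w j (++⁻ʳ (ν φ) hs)) (r j j≤k))

MasterConditions : Formula n → Word n → FSet n → FSet n → Set
MasterConditions {n} φ w Xs Ys =
    ((ψ : Formula n) → Xs ψ ≡ true → ψ ∈ μ φ)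
  × ((ψ : Formula n) → Ys ψ ≡ true → ψ ∈ ν φ)
  × (Σ ℕ λ i → suffix w i ⊨ (afPrefix φ w i) [ Xs ]ν)
  × ((ψ : Formula n) → Xs ψ ≡ true → w ⊨ G (F (ψ [ Ys ]μ)))
  × ((ψ : Formula n) → Ys ψ ≡ true → w ⊨ F (G (ψ [ Xs ]ν)))

-- This direction holds for arbitrary X and Y, not only for subsets of μ(φ) and ν(φ).
module _ {n} {w : Word n} {Xs Ys : FSet n}
         (X-recurrent : ∀ ψ → Xs ψ ≡ true → w ⊨ G (F (ψ [ Ys ]μ)))
         (Y-persistent : ∀ ψ → Ys ψ ≡ true → w ⊨ F (G (ψ [ Xs ]ν))) where

  ∈X⇒GF : ∀ ψ → All (∈⇒FG Ys w) (ν ψ) → ∈⇒GF Xs w ψ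
  ∈X⇒GF ψ h ψ∈X k = K + j , ⊨-suffix-reindex ψ w (k + K) j k (K + j) (+-assoc k K j) ψ-at-k+K+j
    where
    stable : Eventually (λ m → All (∈⇒G Ys (suffix w m)) (ν ψ))
    stable = eventually-All
      (All.map (λ {c} c∈Y⇒FG → eventually-⇒ (Ys c ≟ᵇ true) (FG⇒eventually-G c w ∘ c∈Y⇒FG)) h)
    K = proj₁ stable
    j = proj₁ (X-recurrent ψ ψ∈X (k + K))
    ψ-at-k+K+j : suffix (suffix w (k + K)) j ⊨ ψ
    ψ-at-k+K+j = ⊨-[]μ⁻ Ys ψ (suffix (suffix w (k + K)) j)
      (All.map (∈⇒G-suffix Ys (suffix w (k + K)) j) (proj₂ stable (k + K) (m≤n+m K k)))
      (proj₂ (X-recurrent ψ ψ∈X (k + K)))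

  ∈Y⇒FG : ∀ ψ → All (∈⇒GF Xs w) (μ ψ) → ∈⇒FG Ys w ψ
  ∈Y⇒FG ψ h ψ∈Y =
    let (k , g) = Y-persistent ψ ψ∈Y in
    k , λ j → ⊨-[]ν⁻ Xs ψ (suffix (suffix w k) j) (All.map (∈⇒GF-suffix Xs (suffix w k) j) (All.map (∈⇒GF-suffix Xs w k) h)) (g j)

  private
    ++⁺-× : ∀ {P Q : Formula n → Set} {xs xs′ ys ys′} →
            All P xs × All Q ys → All P xs′ × All Q ys′ → All P (xs ++ xs′) × All Q (ys ++ ys′)
    ++⁺-× (p , q) (p′ , q′) = ++⁺ p p′ , ++⁺ q q′

  guesses-sound : ∀ (φ : Formula n) → All (∈⇒GF Xs w) (μ φ) × All (∈⇒FG Ys w) (ν φ)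
  guesses-sound tt = [] , []
  guesses-sound ff = [] , []
  guesses-sound (var a) = [] , []
  guesses-sound (nvar a) = [] , []
  guesses-sound (φ ∧ ψ) = ++⁺-× (guesses-sound φ) (guesses-sound ψ)
  guesses-sound (φ ∨ ψ) = ++⁺-× (guesses-sound φ) (guesses-sound ψ)
  guesses-sound (X φ) = guesses-sound φ
  guesses-sound (F φ) = let (hμ , hν) = guesses-sound φ in ∈X⇒GF (F φ) hν ∷ hμ , hν
  guesses-sound (G φ) = let (hμ , hν) = guesses-sound φ in hμ , ∈Y⇒FG (G φ) hμ ∷ hν
  guesses-sound (φ U ψ) =
    let (hμ , hν) = ++⁺-× (guesses-sound φ) (guesses-sound ψ) in ∈X⇒GF (φ U ψ) hν ∷ hμ , hν
  guesses-sound (φ W ψ) =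
    let (hμ , hν) = ++⁺-× (guesses-sound φ) (guesses-sound ψ) in hμ , ∈Y⇒FG (φ W ψ) hμ ∷ hν
  guesses-sound (φ M ψ) =
    let (hμ , hν) = ++⁺-× (guesses-sound φ) (guesses-sound ψ) in ∈X⇒GF (φ M ψ) hν ∷ hμ , hν
  guesses-sound (φ R ψ) =
    let (hμ , hν) = ++⁺-× (guesses-sound φ) (guesses-sound ψ) in hμ , ∈Y⇒FG (φ R ψ) hμ ∷ hν

  conditions-sound : ∀ (φ : Formula n) → (Σ ℕ λ i → suffix w i ⊨ (afPrefix φ w i) [ Xs ]ν) → w ⊨ φ
  conditions-sound φ (i , p) = ⊨-afPrefix⁻ φ w i (⊨-[]ν⁻ Xs (afPrefix φ w i) (suffix w i) X-recurrent-at-i p)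
    where
    X-recurrent-at-i : All (∈⇒GF Xs (suffix w i)) (μ (afPrefix φ w i))
    X-recurrent-at-i = All.map (∈⇒GF-suffix Xs w i) (proj₁ (guesses-sound (afPrefix φ w i)))

module _ (em : ExcludedMiddle 0ℓ) {n} (φ : Formula n) (w : Word n) where

  μ-GF ν-FG : FSet n
  μ-GF c = does (em {c ∈ μ φ × w ⊨ G (F c)})
  ν-FG c = does (em {c ∈ ν φ × w ⊨ F (G c)})

  μ-GF-spec : ∀ {c} → μ-GF c ≡ true → c ∈ μ φ × w ⊨ G (F c)
  μ-GF-spec e = invert (subst (Reflects _) e (proof em))

  ν-FG-spec : ∀ {c} → ν-FG c ≡ true → c ∈ ν φ × w ⊨ F (G c)
  ν-FG-spec e = invert (subst (Reflects _) e (proof em))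

  ν-FG-complete : All (FG⇒∈ ν-FG w) (ν φ)
  ν-FG-complete = All.tabulate λ c∈ν → dec-true em ∘ (c∈ν ,_)

  stabilised : Eventually λ m → All (F⇒∈ μ-GF (suffix w m)) (μ φ) × All (∈⇒G ν-FG (suffix w m)) (ν φ)
  stabilised = eventually-×
    (eventually-All (All.tabulate λ {c} c∈μ →
      eventually-map (λ F⇒GF → dec-true em ∘ (c∈μ ,_) ∘ F⇒GF) (eventually-F⇒GF em c w)))
    (eventually-All (All.tabulate λ {c} _ →
      eventually-⇒ (ν-FG c ≟ᵇ true) (FG⇒eventually-G c w ∘ proj₂ ∘ ν-FG-spec)))

  private
    K : ℕ
    K = proj₁ stabilised

  μ-GF-recurrent : ∀ ψ → μ-GF ψ ≡ true → w ⊨ G (F (ψ [ ν-FG ]μ))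
  μ-GF-recurrent ψ e k =
    let (ψ∈μ , GFψ) = μ-GF-spec e ; (j , p) = GFψ k in
    j , ⊨-[]μ⁺ ν-FG ψ (suffix (suffix w k) j)
          (All.map (FG⇒∈-suffix ν-FG (suffix w k) j)
            (All.map (FG⇒∈-suffix ν-FG w k) (All.lookup (ν-of-μ φ ν-FG-complete) ψ∈μ)))
          p

  ν-FG-persistent : ∀ ψ → ν-FG ψ ≡ true → w ⊨ F (G (ψ [ μ-GF ]ν))
  ν-FG-persistent ψ e = K , λ j →
    ⊨-suffix-+⁻ (ψ [ μ-GF ]ν) w K j
      (⊨-[]ν⁺ μ-GF ψ (suffix w (K + j))
        (All.lookup (μ-of-ν φ (proj₁ (proj₂ stabilised (K + j) (m≤m+n K j)))) ψ∈ν)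
        (⊨-suffix-+⁺ ψ w K j (Gψ j)))
    where
    ψ∈ν = proj₁ (ν-FG-spec e)
    Gψ : suffix w K ⊨ G ψ
    Gψ = All.lookup (proj₂ (proj₂ stabilised K ≤-refl)) ψ∈ν e

  conditions-complete : w ⊨ φ → MasterConditions φ w μ-GF ν-FG
  conditions-complete w⊨φ =
    (λ _ → proj₁ ∘ μ-GF-spec) , (λ _ → proj₁ ∘ ν-FG-spec) ,
    (K , φ-at-K) , μ-GF-recurrent , ν-FG-persistent
    where
    φ-at-K : suffix w K ⊨ (afPrefix φ w K) [ μ-GF ]ν
    φ-at-K = ⊨-[]ν⁺ μ-GF (afPrefix φ w K) (suffix w K)
      (μ-afPrefix φ w K (proj₁ (proj₂ stabilised K ≤-refl)))
      (⊨-afPrefix⁺ φ w K w⊨φ)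

theorem5p12 : ExcludedMiddle 0ℓ → ∀ {n} (φ : Formula n) (w : Word n) →
    (w ⊨ φ) ⇔
    (Σ (FSet n) λ Xs → Σ (FSet n) λ Ys →
        ((ψ : Formula n) → Xs ψ ≡ true → ψ ∈ μ φ)
      × ((ψ : Formula n) → Ys ψ ≡ true → ψ ∈ ν φ)
      × (Σ ℕ λ i → suffix w i ⊨ (afPrefix φ w i) [ Xs ]ν)
      × ((ψ : Formula n) → Xs ψ ≡ true → w ⊨ G (F (ψ [ Ys ]μ)))
      × ((ψ : Formula n) → Ys ψ ≡ true → w ⊨ F (G (ψ [ Xs ]ν))))
theorem5p12 em φ w = mk⇔
  (λ w⊨φ → μ-GF em φ w , ν-FG em φ w , conditions-complete em φ w w⊨φ)
  (λ (_ , _ , _ , _ , afPrefix-holds , X-recurrent , Y-persistent) →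
     conditions-sound X-recurrent Y-persistent φ afPrefix-holds)
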